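{- (1) Let $s,t$ be odd integers and $a\ge1$ an integer. For every integer $n\ge1$, $$\nu(\{n\}_{2^a s,\,2t})=\begin{cases}\lfloor n/2\rfloor+\delta_{4\mathbb Z}(n)\bigl[\nu\bigl(n\{4\}_{2s,2t}/4\bigr)-2\bigr] & \text{if } a=1,\\ \lfloor n/2\rfloor+\delta_E(n)\bigl[\nu(n)+a-2\bigr] & \text{if } a\ge 2.\end{cases}$$ (2) Let $s,t$ be arbitrary integers. For every integer $n\ge1$, $$\nu(\{n\}_{2s,\,4t})=n-1+\nu(\{n\}_{s,t}).$$
   Context: For integers $u,v$, the sequence $\{n\}_{u,v}$ is defined by $\{0\}_{u,v}=0$, $\{1\}_{u,v}=1$, $\{n\}_{u,v}=u\{n-1\}_{u,v}+v\{n-2\}_{u,v}$ for $n\ge2$ (so $\{4\}_{u,v}=u^3+2uv$). $\nu=\nu_2$ is the $2$-adic valuation ($\nu(0)=\infty$). For a set $S$ of integers, $\delta_S(k)=1$ if $k\in S$ and $0$ otherwise; $E$ is the set of even integers and $4\mathbb Z$ the set of multiples of $4$. -}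

module Defs where

open import Data.Nat as ℕ using (ℕ; zero; suc)
open import Data.Integer as ℤ using (ℤ; +_; ∣_∣)
open import Data.Integer.DivMod using (_/ℕ_)
open import Data.Nat.Divisibility using (_∣_; _∣?_)
open import Relation.Nullary using (yes; no)
open import Data.Product using (∃)
open import Relation.Binary.PropositionalEquality using (_≡_)

seq : ℤ → ℤ → ℕ → ℤ
seq u v zero = + 0
seq u v (suc zero) = + 1
seq u v (suc (suc n)) = u ℤ.* seq u v (suc n) ℤ.+ v ℤ.* seq u v n

-- Naturals extended by ∞ (value of ν at 0).
data ℕ∞ : Set where
  fin : ℕ → ℕ∞
  ∞   : ℕ∞

infixl 6 _+∞_ _∸∞_
_+∞_ : ℕ∞ → ℕ∞ → ℕ∞
fin m +∞ fin n = fin (m ℕ.+ n)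
_ +∞ _ = ∞

_∸∞_ : ℕ∞ → ℕ → ℕ∞
fin m ∸∞ k = fin (m ℕ.∸ k)
∞ ∸∞ k = ∞

-- 2-adic valuation of a positive natural, with fuel (fuel m suffices for m)
val2 : ℕ → ℕ → ℕ
val2 zero m = 0
val2 (suc f) m with m ℕ.% 2
... | zero = suc (val2 f (m ℕ./ 2))
... | suc _ = 0

ν : ℤ → ℕ∞
ν x with ∣ x ∣
... | zero = ∞
... | suc m = fin (val2 (suc m) (suc m))

δ-mult : ℕ → ℕ → ℕ∞ → ℕ∞
δ-mult d n x with d ∣? n
... | yes _ = x
... | no _ = fin 0

δ4ℤ : ℕ → ℕ∞ → ℕ∞
δ4ℤ = δ-mult 4

δE : ℕ → ℕ∞ → ℕ∞
δE = δ-mult 2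

Odd : ℤ → Set
Odd s = ∃ λ k → s ≡ + 1 ℤ.+ + 2 ℤ.* k

-- Two identities drive the proof: scaling, {n}_{cu,c²v} = c^(n-1) {n}_{u,v}, which gives (2) at once,
-- and index doubling, {2k}_{u,v} = u {k}_{u²+2v,-v²}.  For (1) write u = 2U, v = 2t with t odd.
-- At odd indices an induction shows {2k+1}_{2U,2t} = 2^k · odd.  At even indices doubling followed by
-- scaling gives {2m}_{2U,2t} = 2U · 2^(m-1) · {m}_{2B,Q} with B = U² + t and Q = -t² odd.
-- When B is odd, doubling maps (2B, Q) to (2(2B² + Q), -Q²), again of the same shape, so
-- ν{m}_{2B,Q} = ν(m); this settles a ≥ 2, where U is even.  For a = 1 the number B = s² + t is even,
-- and one more doubling step contributes ν(B), which is where {4}_{2s,2t} = 8sB enters.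

module Submission where

open import Defs
open import Data.Nat as ℕ using (ℕ; zero; suc; _≤_; _<_; _^_; z≤n; s≤s)
open import Data.Integer as ℤ using (ℤ; +_; -[1+_]; -_; ∣_∣)
open import Data.Integer.DivMod using (_/ℕ_)
open import Data.Nat.Divisibility using (_∣_; divides; _∣?_; ∣-trans; ∣1⇒≡1; ∣m+n∣m⇒∣n; n∣m*n; *-cancelʳ-∣)
open import Relation.Nullary using (¬_; yes; no; contradiction)
open import Data.Nat.Induction using (<-rec)
open import Data.Product using (_×_; _,_; proj₂; ∃; ∃₂)
open import Relation.Binary.PropositionalEquality
import Data.Nat.Properties as ℕₚ
open import Data.Nat.DivMod using ([m+kn]%n≡m%n; m*n%n≡0; m*n/n≡m; +-distrib-/-∣ʳ)
import Data.Integer.Properties as ℤₚ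
import Data.Nat.Tactic.RingSolver as ℕ-Solver
import Data.Integer.Tactic.RingSolver as ℤ-Solver

-- Indices are written k * 2 rather than 2 * k so that suc k * 2 reduces to suc (suc (k * 2)).
data Halving : ℕ → Set where
  even : ∀ k → Halving (k ℕ.* 2)
  odd  : ∀ k → Halving (1 ℕ.+ k ℕ.* 2)

halving : ∀ n → Halving n
halving zero = even 0
halving (suc n) with halving n
... | even k = odd k
... | odd k  = even (suc k)

halving-rec : ∀ {ℓ} (P : ℕ → Set ℓ) → P 0 → (∀ k → P (1 ℕ.+ k ℕ.* 2)) →
              (∀ k → P k → P (k ℕ.* 2)) → ∀ n → P n
halving-rec P P0 P-odd P-even = <-rec P step
  where
  step : ∀ n → (∀ {m} → m < n → P m) → P n
  step n rec with halving n
  ... | odd k        = P-odd k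
  ... | even zero    = P0
  ... | even (suc k) = P-even (suc k) (rec (s≤s (s≤s (ℕₚ.m≤m*n k 2))))

n<2^n : ∀ n → n < 2 ^ n
n<2^n zero    = s≤s z≤n
n<2^n (suc n) = ℕₚ.≤-trans (ℕₚ.≤-reflexive (cong suc (ℕₚ.+-comm 1 n)))
  (ℕₚ.+-mono-≤ (n<2^n n) (ℕₚ.≤-trans (ℕₚ.m^n>0 2 n) (ℕₚ.m≤m+n _ 0)))

val2-odd : ∀ f r → val2 (suc f) (1 ℕ.+ r ℕ.* 2) ≡ 0
val2-odd f r with (1 ℕ.+ r ℕ.* 2) ℕ.% 2 | [m+kn]%n≡m%n 1 r 2
... | _ | refl = refl

val2-*2 : ∀ f m → val2 (suc f) (m ℕ.* 2) ≡ suc (val2 f m)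
val2-*2 f m with (m ℕ.* 2) ℕ.% 2 | m*n%n≡0 m 2
... | _ | refl = cong (λ h → suc (val2 f h)) (m*n/n≡m m 2)

val2-2^j*odd : ∀ j r {f} → j < f → val2 f (2 ^ j ℕ.* (1 ℕ.+ r ℕ.* 2)) ≡ j
val2-2^j*odd zero    r {suc f} _ =
  trans (cong (val2 (suc f)) (ℕₚ.*-identityˡ (1 ℕ.+ r ℕ.* 2))) (val2-odd f r)
val2-2^j*odd (suc j) r {suc f} (s≤s j<f) = begin
  val2 (suc f) (2 ^ suc j ℕ.* X)   ≡⟨ cong (val2 (suc f)) (shift (2 ^ j) X) ⟩
  val2 (suc f) (2 ^ j ℕ.* X ℕ.* 2) ≡⟨ val2-*2 f (2 ^ j ℕ.* X) ⟩
  suc (val2 f (2 ^ j ℕ.* X))       ≡⟨ cong suc (val2-2^j*odd j r j<f) ⟩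
  suc j                             ∎
  where
  open ≡-Reasoning
  X = 1 ℕ.+ r ℕ.* 2
  shift : ∀ p x → 2 ℕ.* p ℕ.* x ≡ p ℕ.* x ℕ.* 2
  shift = ℕ-Solver.solve-∀

pow2*odd-decomposition : ∀ n → 0 < n → ∃₂ λ j r → n ≡ 2 ^ j ℕ.* (1 ℕ.+ r ℕ.* 2)
pow2*odd-decomposition = halving-rec P (λ ()) P-odd P-even
  where
  P : ℕ → Set
  P n = 0 < n → ∃₂ λ j r → n ≡ 2 ^ j ℕ.* (1 ℕ.+ r ℕ.* 2)
  P-odd : ∀ k → P (1 ℕ.+ k ℕ.* 2)
  P-odd k _ = 0 , k , sym (ℕₚ.*-identityˡ _)
  P-even : ∀ k → P k → P (k ℕ.* 2)
  P-even (suc k) P-k _ with P-k (s≤s z≤n)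
  ... | j , r , eq = suc j , r , trans (cong (ℕ._* 2) eq) (shift (2 ^ j) (1 ℕ.+ r ℕ.* 2))
    where
    shift : ∀ p x → p ℕ.* x ℕ.* 2 ≡ 2 ℕ.* p ℕ.* x
    shift = ℕ-Solver.solve-∀

ν-abs : ∀ x → ν x ≡ ν (+ ∣ x ∣)
ν-abs (+ n)    = refl
ν-abs -[1+ n ] = refl

ν-+ : ∀ n .{{_ : ℕ.NonZero n}} → ν (+ n) ≡ fin (val2 n n)
ν-+ (suc n) = refl

ν-2^j*odd : ∀ j r → ν (+ (2 ^ j ℕ.* (1 ℕ.+ r ℕ.* 2))) ≡ fin j
ν-2^j*odd j r =
  trans (ν-+ N {{ℕₚ.m*n≢0 (2 ^ j) X {{ℕₚ.m^n≢0 2 j}}}})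
        (cong fin (val2-2^j*odd j r (ℕₚ.≤-trans (n<2^n j) (ℕₚ.m≤m*n (2 ^ j) X))))
  where
  X = 1 ℕ.+ r ℕ.* 2
  N = 2 ^ j ℕ.* X

ν-+-* : ∀ m n → ν (+ (m ℕ.* n)) ≡ ν (+ m) +∞ ν (+ n)
ν-+-* zero    n       = refl
ν-+-* (suc m) zero    rewrite ℕₚ.*-zeroʳ m = refl
ν-+-* (suc m) (suc n)
  with pow2*odd-decomposition (suc m) (s≤s z≤n) | pow2*odd-decomposition (suc n) (s≤s z≤n)
... | j , r , m≡ | k , q , n≡ = begin
  ν (+ (suc m ℕ.* suc n))
    ≡⟨ cong (λ p → ν (+ p)) (trans (cong₂ ℕ._*_ m≡ n≡) (product (2 ^ j) (2 ^ k) r q)) ⟩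
  ν (+ (2 ^ j ℕ.* 2 ^ k ℕ.* (1 ℕ.+ (r ℕ.+ q ℕ.+ r ℕ.* q ℕ.* 2) ℕ.* 2)))
    ≡⟨ cong (λ p → ν (+ (p ℕ.* (1 ℕ.+ (r ℕ.+ q ℕ.+ r ℕ.* q ℕ.* 2) ℕ.* 2)))) (sym (ℕₚ.^-distribˡ-+-* 2 j k)) ⟩
  ν (+ (2 ^ (j ℕ.+ k) ℕ.* (1 ℕ.+ (r ℕ.+ q ℕ.+ r ℕ.* q ℕ.* 2) ℕ.* 2)))
    ≡⟨ ν-2^j*odd (j ℕ.+ k) (r ℕ.+ q ℕ.+ r ℕ.* q ℕ.* 2) ⟩
  fin (j ℕ.+ k)
    ≡⟨ cong₂ _+∞_ (trans (cong (λ p → ν (+ p)) m≡) (ν-2^j*odd j r))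
                  (trans (cong (λ p → ν (+ p)) n≡) (ν-2^j*odd k q)) ⟨
  ν (+ suc m) +∞ ν (+ suc n) ∎
  where
  open ≡-Reasoning
  product : ∀ p p′ r q → p ℕ.* (1 ℕ.+ r ℕ.* 2) ℕ.* (p′ ℕ.* (1 ℕ.+ q ℕ.* 2))
                       ≡ p ℕ.* p′ ℕ.* (1 ℕ.+ (r ℕ.+ q ℕ.+ r ℕ.* q ℕ.* 2) ℕ.* 2)
  product = ℕ-Solver.solve-∀

ν-* : ∀ x y → ν (x ℤ.* y) ≡ ν x +∞ ν y
ν-* x y = begin
  ν (x ℤ.* y)                    ≡⟨ ν-abs (x ℤ.* y) ⟩
  ν (+ ∣ x ℤ.* y ∣)              ≡⟨ cong (λ p → ν (+ p)) (ℤₚ.abs-* x y) ⟩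
  ν (+ (∣ x ∣ ℕ.* ∣ y ∣))        ≡⟨ ν-+-* ∣ x ∣ ∣ y ∣ ⟩
  ν (+ ∣ x ∣) +∞ ν (+ ∣ y ∣)     ≡⟨ cong₂ _+∞_ (ν-abs x) (ν-abs y) ⟨
  ν x +∞ ν y                      ∎
  where open ≡-Reasoning

pos-[1+q*2] : ∀ q → + (1 ℕ.+ q ℕ.* 2) ≡ + 1 ℤ.+ + 2 ℤ.* + q
pos-[1+q*2] q = trans (ℤₚ.pos-+ 1 (q ℕ.* 2)) (cong (ℤ._+_ (+ 1)) (trans (ℤₚ.pos-* q 2) (ℤₚ.*-comm (+ q) (+ 2))))

∣odd∣ : ∀ {o} → Odd o → ∃ λ q → ∣ o ∣ ≡ 1 ℕ.+ q ℕ.* 2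
∣odd∣ (+ q , refl)      = q , cong ∣_∣ (sym (pos-[1+q*2] q))
∣odd∣ (-[1+ q ] , refl) = q , (begin
  ∣ + 1 ℤ.+ + 2 ℤ.* -[1+ q ] ∣       ≡⟨ cong (λ z → ∣ + 1 ℤ.+ + 2 ℤ.* - z ∣) (ℤₚ.pos-+ 1 q) ⟩
  ∣ + 1 ℤ.+ + 2 ℤ.* - (+ 1 ℤ.+ + q) ∣ ≡⟨ cong ∣_∣ (negate (+ q)) ⟩
  ∣ - (+ 1 ℤ.+ + 2 ℤ.* + q) ∣         ≡⟨ ℤₚ.∣-i∣≡∣i∣ (+ 1 ℤ.+ + 2 ℤ.* + q) ⟩
  ∣ + 1 ℤ.+ + 2 ℤ.* + q ∣             ≡⟨ cong ∣_∣ (pos-[1+q*2] q) ⟨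
  1 ℕ.+ q ℕ.* 2                        ∎)
  where
  open ≡-Reasoning
  negate : ∀ x → + 1 ℤ.+ + 2 ℤ.* - (+ 1 ℤ.+ x) ≡ - (+ 1 ℤ.+ + 2 ℤ.* x)
  negate = ℤ-Solver.solve-∀

ν-odd : ∀ {o} → Odd o → ν o ≡ fin 0
ν-odd {o} o-odd with ∣odd∣ o-odd
... | q , eq = begin
  ν o                              ≡⟨ ν-abs o ⟩
  ν (+ ∣ o ∣)                      ≡⟨ cong (λ p → ν (+ p)) (trans eq (sym (ℕₚ.*-identityˡ _))) ⟩
  ν (+ (2 ^ 0 ℕ.* (1 ℕ.+ q ℕ.* 2))) ≡⟨ ν-2^j*odd 0 q ⟩
  fin 0                            ∎
  where open ≡-Reasoning

ν-2^ : ∀ k → ν ((+ 2) ℤ.^ k) ≡ fin k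
ν-2^ zero    = refl
ν-2^ (suc k) = trans (ν-* (+ 2) ((+ 2) ℤ.^ k)) (cong (fin 1 +∞_) (ν-2^ k))

ν-+2^ : ∀ j → ν (+ (2 ^ j)) ≡ fin j
ν-+2^ j = trans (cong (λ p → ν (+ p)) (sym (ℕₚ.*-identityʳ (2 ^ j)))) (ν-2^j*odd j 0)

ν-+*2 : ∀ k → ν (+ (k ℕ.* 2)) ≡ fin 1 +∞ ν (+ k)
ν-+*2 k = trans (cong (λ p → ν (+ p)) (ℕₚ.*-comm k 2)) (ν-+-* 2 k)

seq-scale : ∀ c u v n → seq (c ℤ.* u) (c ℤ.* c ℤ.* v) (suc n) ≡ c ℤ.^ n ℤ.* seq u v (suc n)
seq-scale c u v zero          = refl
seq-scale c u v (suc zero)    = base c u v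
  where
  base : ∀ c u v → c ℤ.* u ℤ.* + 1 ℤ.+ c ℤ.* c ℤ.* v ℤ.* + 0 ≡ c ℤ.* + 1 ℤ.* (u ℤ.* + 1 ℤ.+ v ℤ.* + 0)
  base = ℤ-Solver.solve-∀
seq-scale c u v (suc (suc n)) = begin
  c ℤ.* u ℤ.* seq (c ℤ.* u) (c ℤ.* c ℤ.* v) (2 ℕ.+ n) ℤ.+ c ℤ.* c ℤ.* v ℤ.* seq (c ℤ.* u) (c ℤ.* c ℤ.* v) (suc n)
    ≡⟨ cong₂ (λ a b → c ℤ.* u ℤ.* a ℤ.+ c ℤ.* c ℤ.* v ℤ.* b) (seq-scale c u v (suc n)) (seq-scale c u v n) ⟩
  c ℤ.* u ℤ.* (c ℤ.* c ℤ.^ n ℤ.* seq u v (2 ℕ.+ n)) ℤ.+ c ℤ.* c ℤ.* v ℤ.* (c ℤ.^ n ℤ.* seq u v (suc n))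
    ≡⟨ regroup c u v (c ℤ.^ n) (seq u v (2 ℕ.+ n)) (seq u v (suc n)) ⟩
  c ℤ.* (c ℤ.* c ℤ.^ n) ℤ.* (u ℤ.* seq u v (2 ℕ.+ n) ℤ.+ v ℤ.* seq u v (suc n)) ∎
  where
  open ≡-Reasoning
  regroup : ∀ c u v p a b → c ℤ.* u ℤ.* (c ℤ.* p ℤ.* a) ℤ.+ c ℤ.* c ℤ.* v ℤ.* (p ℤ.* b)
                          ≡ c ℤ.* (c ℤ.* p) ℤ.* (u ℤ.* a ℤ.+ v ℤ.* b)
  regroup = ℤ-Solver.solve-∀

seq-two-step : ∀ u v n → seq u v (4 ℕ.+ n)
             ≡ (u ℤ.* u ℤ.+ + 2 ℤ.* v) ℤ.* seq u v (2 ℕ.+ n) ℤ.+ - (v ℤ.* v) ℤ.* seq u v n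
seq-two-step u v n = unfolded u v (seq u v (suc n)) (seq u v n)
  where
  unfolded : ∀ u v a b → u ℤ.* (u ℤ.* (u ℤ.* a ℤ.+ v ℤ.* b) ℤ.+ v ℤ.* a) ℤ.+ v ℤ.* (u ℤ.* a ℤ.+ v ℤ.* b)
                       ≡ (u ℤ.* u ℤ.+ + 2 ℤ.* v) ℤ.* (u ℤ.* a ℤ.+ v ℤ.* b) ℤ.+ - (v ℤ.* v) ℤ.* b
  unfolded = ℤ-Solver.solve-∀

seq-double : ∀ u v k → seq u v (k ℕ.* 2) ≡ u ℤ.* seq (u ℤ.* u ℤ.+ + 2 ℤ.* v) (- (v ℤ.* v)) k
seq-double u v zero          = sym (ℤₚ.*-zeroʳ u)
seq-double u v (suc zero)    = base u v
  where
  base : ∀ u v → u ℤ.* + 1 ℤ.+ v ℤ.* + 0 ≡ u ℤ.* + 1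
  base = ℤ-Solver.solve-∀
seq-double u v (suc (suc k)) = begin
  seq u v (4 ℕ.+ k ℕ.* 2)
    ≡⟨ seq-two-step u v (k ℕ.* 2) ⟩
  u′ ℤ.* seq u v (suc k ℕ.* 2) ℤ.+ v′ ℤ.* seq u v (k ℕ.* 2)
    ≡⟨ cong₂ (λ a b → u′ ℤ.* a ℤ.+ v′ ℤ.* b) (seq-double u v (suc k)) (seq-double u v k) ⟩
  u′ ℤ.* (u ℤ.* seq u′ v′ (suc k)) ℤ.+ v′ ℤ.* (u ℤ.* seq u′ v′ k)
    ≡⟨ regroup u u′ v′ (seq u′ v′ (suc k)) (seq u′ v′ k) ⟩
  u ℤ.* (u′ ℤ.* seq u′ v′ (suc k) ℤ.+ v′ ℤ.* seq u′ v′ k) ∎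
  where
  open ≡-Reasoning
  u′ = u ℤ.* u ℤ.+ + 2 ℤ.* v
  v′ = - (v ℤ.* v)
  regroup : ∀ u u′ v′ a b → u′ ℤ.* (u ℤ.* a) ℤ.+ v′ ℤ.* (u ℤ.* b) ≡ u ℤ.* (u′ ℤ.* a ℤ.+ v′ ℤ.* b)
  regroup = ℤ-Solver.solve-∀

Even : ℤ → Set
Even x = ∃ λ e → x ≡ + 2 ℤ.* e

odd-* : ∀ {a b} → Odd a → Odd b → Odd (a ℤ.* b)
odd-* (x , refl) (y , refl) = x ℤ.+ y ℤ.+ + 2 ℤ.* x ℤ.* y , expand x y
  where
  expand : ∀ x y → (+ 1 ℤ.+ + 2 ℤ.* x) ℤ.* (+ 1 ℤ.+ + 2 ℤ.* y)
                 ≡ + 1 ℤ.+ + 2 ℤ.* (x ℤ.+ y ℤ.+ + 2 ℤ.* x ℤ.* y)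
  expand = ℤ-Solver.solve-∀

odd-neg : ∀ {a} → Odd a → Odd (- a)
odd-neg (x , refl) = - + 1 ℤ.- x , negate x
  where
  negate : ∀ x → - (+ 1 ℤ.+ + 2 ℤ.* x) ≡ + 1 ℤ.+ + 2 ℤ.* (- + 1 ℤ.- x)
  negate = ℤ-Solver.solve-∀

even-2* : ∀ x y → Even (+ 2 ℤ.* x ℤ.* y)
even-2* x y = x ℤ.* y , ℤₚ.*-assoc (+ 2) x y

even-*ˡ : ∀ x {y} → Even y → Even (x ℤ.* y)
even-*ˡ x (e , refl) = x ℤ.* e , swap x e
  where
  swap : ∀ x e → x ℤ.* (+ 2 ℤ.* e) ≡ + 2 ℤ.* (x ℤ.* e)
  swap = ℤ-Solver.solve-∀

even-+ : ∀ {x y} → Even x → Even y → Even (x ℤ.+ y)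
even-+ (e , refl) (f , refl) = e ℤ.+ f , sym (ℤₚ.*-distribˡ-+ (+ 2) e f)

odd-+ : ∀ {x y} → Even x → Odd y → Odd (x ℤ.+ y)
odd-+ (e , refl) (f , refl) = e ℤ.+ f , shift e f
  where
  shift : ∀ e f → + 2 ℤ.* e ℤ.+ (+ 1 ℤ.+ + 2 ℤ.* f) ≡ + 1 ℤ.+ + 2 ℤ.* (e ℤ.+ f)
  shift = ℤ-Solver.solve-∀

seq-parity : ∀ B {Q} → Odd Q → ∀ k →
             Even (seq (+ 2 ℤ.* B) Q (k ℕ.* 2)) × Odd (seq (+ 2 ℤ.* B) Q (1 ℕ.+ k ℕ.* 2))
seq-parity B Q-odd zero    = (+ 0 , refl) , (+ 0 , refl)
seq-parity B {Q} Q-odd (suc k) with seq-parity B Q-odd k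
... | even-k , odd-k = even-+ (even-2* B _) (even-*ˡ Q even-k) , odd-+ (even-2* B _) (odd-* Q-odd odd-k)

ν-seq[2B,Q]-double : ∀ B Q k → ν (seq (+ 2 ℤ.* B) Q (k ℕ.* 2))
             ≡ fin 1 +∞ ν B +∞ ν (seq (+ 2 ℤ.* (+ 2 ℤ.* (B ℤ.* B) ℤ.+ Q)) (- (Q ℤ.* Q)) k)
ν-seq[2B,Q]-double B Q k = begin
  ν (seq (+ 2 ℤ.* B) Q (k ℕ.* 2))
    ≡⟨ cong ν (seq-double (+ 2 ℤ.* B) Q k) ⟩
  ν (+ 2 ℤ.* B ℤ.* seq (+ 2 ℤ.* B ℤ.* (+ 2 ℤ.* B) ℤ.+ + 2 ℤ.* Q) (- (Q ℤ.* Q)) k)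
    ≡⟨ cong (λ u → ν (+ 2 ℤ.* B ℤ.* seq u (- (Q ℤ.* Q)) k)) (params B Q) ⟩
  ν (+ 2 ℤ.* B ℤ.* seq (+ 2 ℤ.* (+ 2 ℤ.* (B ℤ.* B) ℤ.+ Q)) (- (Q ℤ.* Q)) k)
    ≡⟨ trans (ν-* (+ 2 ℤ.* B) S) (cong (_+∞ ν S) (ν-* (+ 2) B)) ⟩
  fin 1 +∞ ν B +∞ ν S ∎
  where
  open ≡-Reasoning
  S = seq (+ 2 ℤ.* (+ 2 ℤ.* (B ℤ.* B) ℤ.+ Q)) (- (Q ℤ.* Q)) k
  params : ∀ B Q → + 2 ℤ.* B ℤ.* (+ 2 ℤ.* B) ℤ.+ + 2 ℤ.* Q ≡ + 2 ℤ.* (+ 2 ℤ.* (B ℤ.* B) ℤ.+ Q)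
  params = ℤ-Solver.solve-∀

ν-seq[2C,Q] : ∀ n {C Q} → Odd C → Odd Q → ν (seq (+ 2 ℤ.* C) Q n) ≡ ν (+ n)
ν-seq[2C,Q] = halving-rec P (λ _ _ → refl) P-odd P-even
  where
  P : ℕ → Set
  P n = ∀ {C Q} → Odd C → Odd Q → ν (seq (+ 2 ℤ.* C) Q n) ≡ ν (+ n)
  P-odd : ∀ k → P (1 ℕ.+ k ℕ.* 2)
  P-odd k {C} _ Q-odd = trans (ν-odd (proj₂ (seq-parity C Q-odd k))) (sym (ν-odd (+ k , pos-[1+q*2] k)))
  P-even : ∀ k → P k → P (k ℕ.* 2)
  P-even k P-k {C} {Q} C-odd Q-odd = begin
    ν (seq (+ 2 ℤ.* C) Q (k ℕ.* 2))
      ≡⟨ ν-seq[2B,Q]-double C Q k ⟩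
    fin 1 +∞ ν C +∞ ν (seq (+ 2 ℤ.* (+ 2 ℤ.* (C ℤ.* C) ℤ.+ Q)) (- (Q ℤ.* Q)) k)
      ≡⟨ cong₂ (λ a b → fin 1 +∞ a +∞ b) (ν-odd C-odd)
               (P-k (odd-+ (C ℤ.* C , refl) Q-odd) (odd-neg (odd-* Q-odd Q-odd))) ⟩
    fin 1 +∞ ν (+ k)
      ≡⟨ ν-+*2 k ⟨
    ν (+ (k ℕ.* 2)) ∎
    where open ≡-Reasoning

ν-seq[2B,Q]-even : ∀ B {Q} → Odd Q → ∀ k → ν (seq (+ 2 ℤ.* B) Q (k ℕ.* 2)) ≡ fin 1 +∞ ν B +∞ ν (+ k)
ν-seq[2B,Q]-even B {Q} Q-odd k = trans (ν-seq[2B,Q]-double B Q k)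
  (cong (fin 1 +∞ ν B +∞_) (ν-seq[2C,Q] k (odd-+ (B ℤ.* B , refl) Q-odd) (odd-neg (odd-* Q-odd Q-odd))))

seq[2U,2t]-2^k-factor : ∀ U {t} → Odd t → ∀ k →
  (∃ λ y → seq (+ 2 ℤ.* U) (+ 2 ℤ.* t) (k ℕ.* 2) ≡ (+ 2) ℤ.^ k ℤ.* y) ×
  (∃ λ z → Odd z × seq (+ 2 ℤ.* U) (+ 2 ℤ.* t) (1 ℕ.+ k ℕ.* 2) ≡ (+ 2) ℤ.^ k ℤ.* z)
seq[2U,2t]-2^k-factor U t-odd zero = (+ 0 , refl) , (+ 1 , (+ 0 , refl) , refl)
seq[2U,2t]-2^k-factor U {t} t-odd (suc k) with seq[2U,2t]-2^k-factor U t-odd k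
... | (y , y≡) , (z , z-odd , z≡) =
  (y′ , y′≡) , (+ 2 ℤ.* U ℤ.* y′ ℤ.+ t ℤ.* z , odd-+ (even-2* U y′) (odd-* t-odd z-odd) , z′≡)
  where
  p = (+ 2) ℤ.^ k
  y′ = U ℤ.* z ℤ.+ t ℤ.* y
  factor₁ : ∀ U t p y z → + 2 ℤ.* U ℤ.* (p ℤ.* z) ℤ.+ + 2 ℤ.* t ℤ.* (p ℤ.* y) ≡ + 2 ℤ.* p ℤ.* (U ℤ.* z ℤ.+ t ℤ.* y)
  factor₁ = ℤ-Solver.solve-∀
  factor₂ : ∀ U t p y′ z → + 2 ℤ.* U ℤ.* (+ 2 ℤ.* p ℤ.* y′) ℤ.+ + 2 ℤ.* t ℤ.* (p ℤ.* z)
                         ≡ + 2 ℤ.* p ℤ.* (+ 2 ℤ.* U ℤ.* y′ ℤ.+ t ℤ.* z)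
  factor₂ = ℤ-Solver.solve-∀
  y′≡ = trans (cong₂ (λ a b → + 2 ℤ.* U ℤ.* a ℤ.+ + 2 ℤ.* t ℤ.* b) z≡ y≡) (factor₁ U t p y z)
  z′≡ = trans (cong₂ (λ a b → + 2 ℤ.* U ℤ.* a ℤ.+ + 2 ℤ.* t ℤ.* b) y′≡ z≡) (factor₂ U t p y′ z)

ν-seq[2U,2t]-odd : ∀ U {t} → Odd t → ∀ k → ν (seq (+ 2 ℤ.* U) (+ 2 ℤ.* t) (1 ℕ.+ k ℕ.* 2)) ≡ fin k
ν-seq[2U,2t]-odd U t-odd k with proj₂ (seq[2U,2t]-2^k-factor U t-odd k)
... | z , z-odd , z≡ = begin
  ν (seq (+ 2 ℤ.* U) _ (1 ℕ.+ k ℕ.* 2)) ≡⟨ cong ν z≡ ⟩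
  ν ((+ 2) ℤ.^ k ℤ.* z)                  ≡⟨ ν-* ((+ 2) ℤ.^ k) z ⟩
  ν ((+ 2) ℤ.^ k) +∞ ν z                 ≡⟨ cong₂ _+∞_ (ν-2^ k) (ν-odd z-odd) ⟩
  fin (k ℕ.+ 0)                          ≡⟨ cong fin (ℕₚ.+-identityʳ k) ⟩
  fin k                                  ∎
  where open ≡-Reasoning

ν-seq[2U,2t]-even : ∀ U t m → ν (seq (+ 2 ℤ.* U) (+ 2 ℤ.* t) (suc m ℕ.* 2))
  ≡ fin 1 +∞ ν U +∞ (fin m +∞ ν (seq (+ 2 ℤ.* (U ℤ.* U ℤ.+ t)) (- (t ℤ.* t)) (suc m)))
ν-seq[2U,2t]-even U t m = begin
  ν (seq (+ 2 ℤ.* U) (+ 2 ℤ.* t) (suc m ℕ.* 2))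
    ≡⟨ cong ν (seq-double (+ 2 ℤ.* U) (+ 2 ℤ.* t) (suc m)) ⟩
  ν (+ 2 ℤ.* U ℤ.* seq (+ 2 ℤ.* U ℤ.* (+ 2 ℤ.* U) ℤ.+ + 2 ℤ.* (+ 2 ℤ.* t)) (- (+ 2 ℤ.* t ℤ.* (+ 2 ℤ.* t))) (suc m))
    ≡⟨ cong (λ x → ν (+ 2 ℤ.* U ℤ.* x)) (trans (cong₂ (λ u v → seq u v (suc m)) (params₁ U t) (params₂ t))
                                               (seq-scale (+ 2) (+ 2 ℤ.* B) (- (t ℤ.* t)) m)) ⟩
  ν (+ 2 ℤ.* U ℤ.* ((+ 2) ℤ.^ m ℤ.* seq (+ 2 ℤ.* B) (- (t ℤ.* t)) (suc m)))
    ≡⟨ trans (ν-* (+ 2 ℤ.* U) _)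
             (cong₂ _+∞_ (ν-* (+ 2) U) (trans (ν-* ((+ 2) ℤ.^ m) S) (cong (_+∞ ν S) (ν-2^ m)))) ⟩
  fin 1 +∞ ν U +∞ (fin m +∞ ν (seq (+ 2 ℤ.* B) (- (t ℤ.* t)) (suc m))) ∎
  where
  open ≡-Reasoning
  B = U ℤ.* U ℤ.+ t
  S = seq (+ 2 ℤ.* B) (- (t ℤ.* t)) (suc m)
  params₁ : ∀ U t → + 2 ℤ.* U ℤ.* (+ 2 ℤ.* U) ℤ.+ + 2 ℤ.* (+ 2 ℤ.* t) ≡ + 2 ℤ.* (+ 2 ℤ.* (U ℤ.* U ℤ.+ t))
  params₁ = ℤ-Solver.solve-∀
  params₂ : ∀ t → - (+ 2 ℤ.* t ℤ.* (+ 2 ℤ.* t)) ≡ + 2 ℤ.* + 2 ℤ.* (- (t ℤ.* t))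
  params₂ = ℤ-Solver.solve-∀

[i*n]/ℕn≡i : ∀ i n .{{_ : ℕ.NonZero n}} → (i ℤ.* + n) /ℕ n ≡ i
[i*n]/ℕn≡i (+ m)    n         = trans (cong (_/ℕ n) (sym (ℤₚ.pos-* m n))) (cong +_ (m*n/n≡m m n))
[i*n]/ℕn≡i -[1+ m ] n@(suc _) with suc m ℕ.* n ℕ.% n | m*n%n≡0 (suc m) n
... | _ | refl = cong (λ q → - (+ q)) (m*n/n≡m (suc m) n)

[1+k*2]/2≡k : ∀ k → (1 ℕ.+ k ℕ.* 2) ℕ./ 2 ≡ k
[1+k*2]/2≡k k = trans (+-distrib-/-∣ʳ 1 {d = 2} (divides k refl)) (m*n/n≡m k 2)

2∤1+k*2 : ∀ k → ¬ 2 ∣ 1 ℕ.+ k ℕ.* 2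
2∤1+k*2 k 2∣ = contradiction (∣1⇒≡1 (∣m+n∣m⇒∣n (subst (2 ∣_) (ℕₚ.+-comm 1 (k ℕ.* 2)) 2∣) (n∣m*n k))) λ ()

4∤1+k*2 : ∀ k → ¬ 4 ∣ 1 ℕ.+ k ℕ.* 2
4∤1+k*2 k 4∣ = 2∤1+k*2 k (∣-trans (divides 2 refl) 4∣)

4∤[1+k*2]*2 : ∀ k → ¬ 4 ∣ (1 ℕ.+ k ℕ.* 2) ℕ.* 2
4∤[1+k*2]*2 k 4∣ = 2∤1+k*2 k (*-cancelʳ-∣ 2 4∣)

δ-mult-∣ : ∀ {d n} x → d ∣ n → δ-mult d n x ≡ x
δ-mult-∣ {d} {n} x d∣n with d ∣? n
... | yes _   = refl
... | no d∤n = contradiction d∣n d∤n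

δ-mult-∤ : ∀ {d n} x → ¬ d ∣ n → δ-mult d n x ≡ fin 0
δ-mult-∤ {d} {n} x d∤n with d ∣? n
... | yes d∣n = contradiction d∣n d∤n
... | no _    = refl

half+δ-odd : ∀ {d} k {x} → ¬ d ∣ 1 ℕ.+ k ℕ.* 2 →
             fin ((1 ℕ.+ k ℕ.* 2) ℕ./ 2) +∞ δ-mult d (1 ℕ.+ k ℕ.* 2) x ≡ fin k
half+δ-odd k {x} d∤ =
  trans (cong₂ _+∞_ (cong fin ([1+k*2]/2≡k k)) (δ-mult-∤ x d∤)) (cong fin (ℕₚ.+-identityʳ k))

ν-[n*seq4]/4 : ∀ n s t → ν ((+ n ℤ.* seq (+ 2 ℤ.* s) (+ 2 ℤ.* t) 4) /ℕ 4)
                         ≡ ν (+ n) +∞ (fin 1 +∞ (ν s +∞ ν (s ℤ.* s ℤ.+ t)))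
ν-[n*seq4]/4 n s t = begin
  ν ((+ n ℤ.* seq (+ 2 ℤ.* s) (+ 2 ℤ.* t) 4) /ℕ 4)
    ≡⟨ cong (λ x → ν (x /ℕ 4)) (trans (cong (+ n ℤ.*_) (seq-4 s t)) (sym (ℤₚ.*-assoc (+ n) X (+ 4)))) ⟩
  ν ((+ n ℤ.* X ℤ.* + 4) /ℕ 4)
    ≡⟨ cong ν ([i*n]/ℕn≡i (+ n ℤ.* X) 4) ⟩
  ν (+ n ℤ.* X)
    ≡⟨ trans (ν-* (+ n) X) (cong (ν (+ n) +∞_) (trans (ν-* (+ 2) (s ℤ.* B)) (cong (fin 1 +∞_) (ν-* s B)))) ⟩
  ν (+ n) +∞ (fin 1 +∞ (ν s +∞ ν (s ℤ.* s ℤ.+ t))) ∎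
  where
  open ≡-Reasoning
  B = s ℤ.* s ℤ.+ t
  X = + 2 ℤ.* (s ℤ.* B)
  seq-4 : ∀ s t → (+ 2 ℤ.* s) ℤ.* ((+ 2 ℤ.* s) ℤ.* ((+ 2 ℤ.* s) ℤ.* + 1 ℤ.+ (+ 2 ℤ.* t) ℤ.* + 0)
                                   ℤ.+ (+ 2 ℤ.* t) ℤ.* + 1)
                  ℤ.+ (+ 2 ℤ.* t) ℤ.* ((+ 2 ℤ.* s) ℤ.* + 1 ℤ.+ (+ 2 ℤ.* t) ℤ.* + 0)
                ≡ + 2 ℤ.* (s ℤ.* (s ℤ.* s ℤ.+ t)) ℤ.* + 4
  seq-4 = ℤ-Solver.solve-∀

+2^[1+b]*s : ∀ b s → + (2 ^ suc b) ℤ.* s ≡ + 2 ℤ.* (+ (2 ^ b) ℤ.* s)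
+2^[1+b]*s b s = trans (cong (ℤ._* s) (ℤₚ.pos-* 2 (2 ^ b))) (ℤₚ.*-assoc (+ 2) (+ (2 ^ b)) s)

ν-seq[2^a·s,2t]-a≥2 : ∀ b {s t} → Odd s → Odd t → ∀ {n} → Halving n → 1 ≤ n →
  ν (seq (+ (2 ^ (2 ℕ.+ b)) ℤ.* s) (+ 2 ℤ.* t) n) ≡ fin (n ℕ./ 2) +∞ δE n (ν (+ n) +∞ fin (2 ℕ.+ b) ∸∞ 2)
ν-seq[2^a·s,2t]-a≥2 b {s} {t} s-odd t-odd (odd k) _ =
  trans (cong (λ u → ν (seq u (+ 2 ℤ.* t) (1 ℕ.+ k ℕ.* 2))) (+2^[1+b]*s (1 ℕ.+ b) s))
        (trans (ν-seq[2U,2t]-odd _ t-odd k) (sym (half+δ-odd k (2∤1+k*2 k))))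
ν-seq[2^a·s,2t]-a≥2 b {s} {t} s-odd t-odd (even (suc m)) _ = begin
  ν (seq (+ (2 ^ (2 ℕ.+ b)) ℤ.* s) (+ 2 ℤ.* t) (suc m ℕ.* 2))
    ≡⟨ cong (λ u → ν (seq u (+ 2 ℤ.* t) (suc m ℕ.* 2))) (+2^[1+b]*s (1 ℕ.+ b) s) ⟩
  ν (seq (+ 2 ℤ.* U) (+ 2 ℤ.* t) (suc m ℕ.* 2))
    ≡⟨ ν-seq[2U,2t]-even U t m ⟩
  fin 1 +∞ ν U +∞ (fin m +∞ ν (seq (+ 2 ℤ.* (U ℤ.* U ℤ.+ t)) (- (t ℤ.* t)) (suc m)))
    ≡⟨ cong₂ (λ x y → fin 1 +∞ x +∞ (fin m +∞ y))
             ν-U (ν-seq[2C,Q] (suc m) B-odd (odd-neg (odd-* t-odd t-odd))) ⟩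
  fin 1 +∞ fin (1 ℕ.+ b ℕ.+ 0) +∞ (fin m +∞ ν (+ suc m))
    ≡⟨ cong fin (arith (val2 (suc m) (suc m))) ⟩
  fin (suc m) +∞ (fin 1 +∞ ν (+ suc m) +∞ fin (2 ℕ.+ b) ∸∞ 2)
    ≡⟨ cong₂ _+∞_ (cong fin (m*n/n≡m (suc m) 2))
                  (trans (δ-mult-∣ _ (divides (suc m) refl))
                         (cong (λ x → x +∞ fin (2 ℕ.+ b) ∸∞ 2) (ν-+*2 (suc m)))) ⟨
  fin (suc m ℕ.* 2 ℕ./ 2) +∞ δE (suc m ℕ.* 2) (ν (+ (suc m ℕ.* 2)) +∞ fin (2 ℕ.+ b) ∸∞ 2) ∎
  where
  open ≡-Reasoning
  U = + (2 ^ (1 ℕ.+ b)) ℤ.* s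
  B-odd = odd-+ (even-*ˡ U (+ (2 ^ b) ℤ.* s , +2^[1+b]*s b s)) t-odd
  ν-U : ν U ≡ fin (1 ℕ.+ b ℕ.+ 0)
  ν-U = trans (ν-* (+ (2 ^ (1 ℕ.+ b))) s) (cong₂ _+∞_ (ν-+2^ (1 ℕ.+ b)) (ν-odd s-odd))
  shuffle : ∀ b m w → 1 ℕ.+ (1 ℕ.+ b ℕ.+ 0) ℕ.+ (m ℕ.+ w) ≡ suc m ℕ.+ (1 ℕ.+ w ℕ.+ b)
  shuffle = ℕ-Solver.solve-∀
  arith : ∀ w → 1 ℕ.+ (1 ℕ.+ b ℕ.+ 0) ℕ.+ (m ℕ.+ w) ≡ suc m ℕ.+ (1 ℕ.+ w ℕ.+ (2 ℕ.+ b) ℕ.∸ 2)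
  arith w = trans (shuffle b m w) (cong (suc m ℕ.+_) (sym (ℕₚ.+-∸-assoc (1 ℕ.+ w) {2 ℕ.+ b} (s≤s (s≤s z≤n)))))

ν-seq[2s,2t] : ∀ {s t} → Odd s → Odd t → ∀ {n} → Halving n → 1 ≤ n →
  ν (seq (+ 2 ℤ.* s) (+ 2 ℤ.* t) n)
    ≡ fin (n ℕ./ 2) +∞ δ4ℤ n (ν ((+ n ℤ.* seq (+ 2 ℤ.* s) (+ 2 ℤ.* t) 4) /ℕ 4) ∸∞ 2)
ν-seq[2s,2t] {s} {t} s-odd t-odd (odd k) _ =
  trans (ν-seq[2U,2t]-odd s t-odd k) (sym (half+δ-odd k (4∤1+k*2 k)))
ν-seq[2s,2t] {s} {t} s-odd t-odd (even (suc m)) _ = even-index (halving (suc m)) (s≤s z≤n)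
  where
  open ≡-Reasoning
  B = s ℤ.* s ℤ.+ t
  Q-odd = odd-neg (odd-* t-odd t-odd)
  even-index : ∀ {k} → Halving k → 1 ≤ k →
    ν (seq (+ 2 ℤ.* s) (+ 2 ℤ.* t) (k ℕ.* 2))
      ≡ fin (k ℕ.* 2 ℕ./ 2) +∞ δ4ℤ (k ℕ.* 2) (ν ((+ (k ℕ.* 2) ℤ.* seq (+ 2 ℤ.* s) (+ 2 ℤ.* t) 4) /ℕ 4) ∸∞ 2)
  even-index (odd j) _ = begin
    ν (seq (+ 2 ℤ.* s) (+ 2 ℤ.* t) ((1 ℕ.+ j ℕ.* 2) ℕ.* 2))
      ≡⟨ ν-seq[2U,2t]-even s t (j ℕ.* 2) ⟩
    fin 1 +∞ ν s +∞ (fin (j ℕ.* 2) +∞ ν (seq (+ 2 ℤ.* B) (- (t ℤ.* t)) (1 ℕ.+ j ℕ.* 2)))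
      ≡⟨ cong₂ (λ x y → fin 1 +∞ x +∞ (fin (j ℕ.* 2) +∞ y))
               (ν-odd s-odd) (ν-odd (proj₂ (seq-parity B Q-odd j))) ⟩
    fin (1 ℕ.+ j ℕ.* 2) +∞ fin 0
      ≡⟨ cong₂ _+∞_ (cong fin (m*n/n≡m (1 ℕ.+ j ℕ.* 2) 2)) (δ-mult-∤ _ (4∤[1+k*2]*2 j)) ⟨
    _ ∎
  even-index (even (suc j)) _ = begin
    ν (seq (+ 2 ℤ.* s) (+ 2 ℤ.* t) (suc j ℕ.* 2 ℕ.* 2))
      ≡⟨ ν-seq[2U,2t]-even s t (suc (j ℕ.* 2)) ⟩
    fin 1 +∞ ν s +∞ (fin (suc (j ℕ.* 2)) +∞ ν (seq (+ 2 ℤ.* B) (- (t ℤ.* t)) (suc j ℕ.* 2)))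
      ≡⟨ cong₂ (λ x y → fin 1 +∞ x +∞ (fin (suc (j ℕ.* 2)) +∞ y))
               (ν-odd s-odd) (ν-seq[2B,Q]-even B Q-odd (suc j)) ⟩
    fin 1 +∞ (fin (suc (j ℕ.* 2)) +∞ (fin 1 +∞ ν B +∞ ν (+ suc j)))
      ≡⟨ bookkeeping (ν B) (val2 (suc j) (suc j)) ⟩
    fin (suc j ℕ.* 2) +∞ (fin 1 +∞ (fin 1 +∞ ν (+ suc j)) +∞ (fin 1 +∞ (fin 0 +∞ ν B)) ∸∞ 2)
      ≡⟨ cong₂ _+∞_ (cong fin (m*n/n≡m (suc j ℕ.* 2) 2))
                    (trans (δ-mult-∣ _ (divides (suc j) (ℕₚ.*-assoc (suc j) 2 2)))
                           (cong (_∸∞ 2) (trans (ν-[n*seq4]/4 (suc j ℕ.* 2 ℕ.* 2) s t)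
                                                (cong₂ (λ x y → x +∞ (fin 1 +∞ (y +∞ ν B)))
                                                       (trans (ν-+*2 (suc j ℕ.* 2)) (cong (fin 1 +∞_) (ν-+*2 (suc j))))
                                                       (ν-odd s-odd))))) ⟨
    _ ∎
    where
    shuffle : ∀ j c w → 1 ℕ.+ (suc (j ℕ.* 2) ℕ.+ (1 ℕ.+ c ℕ.+ w)) ≡ suc j ℕ.* 2 ℕ.+ (w ℕ.+ (1 ℕ.+ (0 ℕ.+ c)))
    shuffle = ℕ-Solver.solve-∀
    -- x = ν B is ∞ when s² + t = 0, e.g. s = 1, t = -1.
    bookkeeping : ∀ x w → fin 1 +∞ (fin (suc (j ℕ.* 2)) +∞ (fin 1 +∞ x +∞ fin w))
                        ≡ fin (suc j ℕ.* 2) +∞ (fin 1 +∞ (fin 1 +∞ fin w) +∞ (fin 1 +∞ (fin 0 +∞ x)) ∸∞ 2)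
    bookkeeping ∞       w = refl
    bookkeeping (fin c) w = cong fin (shuffle j c w)

ν-seq[2u,4v] : ∀ u v m → ν (seq (+ 2 ℤ.* u) (+ 4 ℤ.* v) (suc m)) ≡ fin m +∞ ν (seq u v (suc m))
ν-seq[2u,4v] u v m = begin
  ν (seq (+ 2 ℤ.* u) (+ 4 ℤ.* v) (suc m))   ≡⟨ cong ν (seq-scale (+ 2) u v m) ⟩
  ν ((+ 2) ℤ.^ m ℤ.* seq u v (suc m))      ≡⟨ ν-* ((+ 2) ℤ.^ m) (seq u v (suc m)) ⟩
  ν ((+ 2) ℤ.^ m) +∞ ν (seq u v (suc m))   ≡⟨ cong (_+∞ ν (seq u v (suc m))) (ν-2^ m) ⟩
  fin m +∞ ν (seq u v (suc m))             ∎
  where open ≡-Reasoning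

lemma3p5 :
    ((s t : ℤ) (a : ℕ) → Odd s → Odd t → 1 ≤ a → (n : ℕ) → 1 ≤ n →
      (a ≡ 1 →
        ν (seq (+ (2 ^ a) ℤ.* s) (+ 2 ℤ.* t) n)
          ≡ fin (n ℕ./ 2) +∞ δ4ℤ n (ν (((+ n) ℤ.* seq (+ 2 ℤ.* s) (+ 2 ℤ.* t) 4) /ℕ 4) ∸∞ 2))
      × (2 ≤ a →
        ν (seq (+ (2 ^ a) ℤ.* s) (+ 2 ℤ.* t) n)
          ≡ fin (n ℕ./ 2) +∞ δE n (ν (+ n) +∞ fin a ∸∞ 2)))
    × ((s t : ℤ) (n : ℕ) → 1 ≤ n →
      ν (seq (+ 2 ℤ.* s) (+ 4 ℤ.* t) n) ≡ fin (n ℕ.∸ 1) +∞ ν (seq s t n))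
lemma3p5 =
  (λ { s t (suc zero) s-odd t-odd _ n 1≤n →
           (λ _ → ν-seq[2s,2t] s-odd t-odd (halving n) 1≤n) , λ { (s≤s ()) }
     ; s t (suc (suc b)) s-odd t-odd _ n 1≤n →
           (λ ()) , λ _ → ν-seq[2^a·s,2t]-a≥2 b s-odd t-odd (halving n) 1≤n }) ,
  λ { s t (suc m) _ → ν-seq[2u,4v] s t m }
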